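{- Let $G=(V,E)$ be a finite graph and $n=|V|$. Then $\lambda(G)=n-p(G)$. Moreover: (1) for any $(H,H')\in\Lambda(G)$, $G_{H\cup H'}$ is a pec decomposition of $G$ with $p(G_{H\cup H'})=p(G)$; (2) for any pec decomposition $G'$ of $G$ with $p(G')=p(G)$, $\Lambda(G')\subseteq\Lambda(G)$.
   Context: For a graph $X$, $\lambda(X)=\max\{|H|+|H'| : H,H' \text{ disjoint matchings of } X\}$ and $\Lambda(X)$ is the set of ordered pairs $(H,H')$ of disjoint matchings of $X$ with $|H|+|H'|=\lambda(X)$. For $F\subseteq E$, $G_F=(V,F)$. A pec decomposition of $G$ is a spanning subgraph $G'=(V,E')$, $E'\subseteq E$, each of whose connected components is a path or a cycle of even length (an isolated vertex counts as a path of length $0$). $p(G')$ is the number of components of $G'$ that are paths, and $p(G)=\min\{p(G') : G' \text{ a pec decomposition of } G\}$. -}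

module Defs where

open import Data.Nat using (ℕ; zero; suc; _+_; _≤_)
open import Data.Nat.Properties using ()
open import Data.Fin using (Fin)
open import Data.Fin.Subset using (Subset; _∈_; _∉_; _⊆_; ∣_∣)
open import Data.List using (List; []; _∷_; map; concatMap; length; allFin; last)
open import Data.List.Relation.Unary.All using (All)
open import Data.List.Relation.Unary.Unique.Propositional using (Unique)
open import Data.List.Relation.Binary.Permutation.Propositional using (_↭_)
import Data.List.Membership.Propositional as LM
open import Data.Maybe using (just)
open import Data.Product using (Σ; ∃; ∃-syntax; _×_; _,_; proj₁; proj₂)
open import Data.Sum using (_⊎_)
open import Relation.Binary.PropositionalEquality using (_≡_; _≢_)
import Data.Unit as U
open import Function.Bundles using (_⇔_)

-- A finite loopless multigraph with vertex set Fin n and edge set Fin m;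
-- edge e has endpoints ends e.
Ends : ℕ → ℕ → Set
Ends n m = Fin m → Fin n × Fin n

Loopless : ∀ {n m} → Ends n m → Set
Loopless ends = ∀ e → proj₁ (ends e) ≢ proj₂ (ends e)

Incident : ∀ {n m} → Ends n m → Fin m → Fin n → Set
Incident ends e v = proj₁ (ends e) ≡ v ⊎ proj₂ (ends e) ≡ v

Joins : ∀ {n m} → Ends n m → Fin m → Fin n → Fin n → Set
Joins ends e u v = ends e ≡ (u , v) ⊎ ends e ≡ (v , u)

-- Subgraphs X = G_F are given by edge subsets F ⊆ E (E = all of Fin m).
-- H is a matching of G_F
IsMatchingOf : ∀ {n m} → Ends n m → Subset m → Subset m → Set
IsMatchingOf ends F H =
  H ⊆ F × (∀ e f v → e ∈ H → f ∈ H → Incident ends e v → Incident ends f v → e ≡ f)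

DisjointMatchings : ∀ {n m} → Ends n m → Subset m → Subset m → Subset m → Set
DisjointMatchings ends F H H' =
  IsMatchingOf ends F H × IsMatchingOf ends F H' × (∀ e → e ∈ H → e ∉ H')

IsLambda : ∀ {n m} → Ends n m → Subset m → ℕ → Set
IsLambda ends F l =
  (∃[ H ] ∃[ H' ] (DisjointMatchings ends F H H' × ∣ H ∣ + ∣ H' ∣ ≡ l))
  × (∀ H H' → DisjointMatchings ends F H H' → ∣ H ∣ + ∣ H' ∣ ≤ l)

InΛ : ∀ {n m} → Ends n m → Subset m → Subset m → Subset m → Set
InΛ ends F H H' = DisjointMatchings ends F H H' × IsLambda ends F (∣ H ∣ + ∣ H' ∣)

-- Components of a pec decomposition, given explicitly.
-- path v₀ [(e₁,v₁),…,(e_k,v_k)] : the path v₀ e₁ v₁ … e_k v_k (k = 0: isolated vertex)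
-- cycle v₀ [(e₁,v₁),…,(e_k,v_k)] with v_k = v₀ : the cycle on v₁,…,v_k
data Comp (n m : ℕ) : Set where
  path  : Fin n → List (Fin m × Fin n) → Comp n m
  cycle : Fin n → List (Fin m × Fin n) → Comp n m

ValidWalk : ∀ {n m} → Ends n m → Fin n → List (Fin m × Fin n) → Set
ValidWalk ends u [] = U.⊤
ValidWalk ends u ((e , v) ∷ st) = Joins ends e u v × ValidWalk ends v st

data Even : ℕ → Set where
  even0  : Even zero
  evenSS : ∀ {k} → Even k → Even (suc (suc k))

ValidComp : ∀ {n m} → Ends n m → Comp n m → Set
ValidComp ends (path v st) = ValidWalk ends v st
ValidComp ends (cycle v st) =
  ValidWalk ends v st × last (map proj₂ st) ≡ just v
  × Even (length st) × 1 ≤ length st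

compVerts : ∀ {n m} → Comp n m → List (Fin n)
compVerts (path v st)  = v ∷ map proj₂ st
compVerts (cycle v st) = map proj₂ st

compEdges : ∀ {n m} → Comp n m → List (Fin m)
compEdges (path v st)  = map proj₁ st
compEdges (cycle v st) = map proj₁ st

-- D describes the spanning subgraph G' = (V, E') as a disjoint union of paths
-- and even cycles covering every vertex exactly once, whose edges are exactly E'.
IsPecDecomposition : ∀ {n m} → Ends n m → Subset m → List (Comp n m) → Set
IsPecDecomposition {n} ends E' D =
  All (ValidComp ends) D
  × concatMap compVerts D ↭ allFin n
  × Unique (concatMap compEdges D)
  × (∀ e → (e ∈ E') ⇔ (e LM.∈ concatMap compEdges D))

isPath : ∀ {n m} → Comp n m → ℕ
isPath (path _ _)  = 1
isPath (cycle _ _) = 0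

pathCount : ∀ {n m} → List (Comp n m) → ℕ
pathCount [] = 0
pathCount (c ∷ D) = isPath c + pathCount D

IsMinPaths : ∀ {n m} → Ends n m → ℕ → Set
IsMinPaths ends p =
  (∃[ E' ] ∃[ D ] (IsPecDecomposition ends E' D × pathCount D ≡ p))
  × (∀ E' D → IsPecDecomposition ends E' D → p ≤ pathCount D)

{-# OPTIONS --safe #-}
-- Two disjoint matchings H, H′ of a loopless graph span a subgraph of maximum degree two whose
-- components alternate between H and H′: paths, and cycles that are even because the colours
-- alternate around them. In any pec decomposition D a path has one vertex more than edges and a
-- cycle as many, so p(D) + |E(D)| = n; for D = G_{H∪H′} this reads p(D) + |H| + |H′| = n.
-- Conversely, the odd-numbered and the even-numbered edges of the components of a pec
-- decomposition D are two disjoint matchings with |H| + |H′| = n − p(D). Hence λ(G) + p(G) = n,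
-- and each construction turns an optimal object into an optimal one, which gives (1) and (2).

module Submission where

open import Defs
open import Data.Bool using (Bool; not)
open import Data.Bool.Properties using (not-involutive; not-¬)
open import Data.Empty using (⊥-elim) renaming (⊥ to Empty)
open import Data.Fin using (Fin; zero; suc)
open import Data.Fin.Properties using (all?) renaming (_≟_ to _≟ᶠ_)
open import Data.Fin.Subset using (Subset; ⊤; _∪_; _-_; _∈_; _∉_; ∣_∣; inside; outside) renaming (⊥ to ∅)
open import Data.Fin.Subset.Properties
  using (_∈?_; anySubset?; ∈⊤; ∉⊥; ∣p∣≤n; x∈p∪q⁺; x∈p∪q⁻; p─q⊆p; x∈p∧x≢y⇒x∈p-y; p─⊥≡p; Empty-unique; ∣⊥∣≡0)
open import Data.List using (List; []; _∷_; _++_; [_]; map; length; concatMap; allFin; last; filter)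
open import Data.List.Properties using (length-++; length-map; map-++; ++-assoc; ++-identityʳ; length-tabulate)
open import Data.List.Membership.Propositional using () renaming (_∈_ to _∈ₗ_)
open import Data.List.Membership.Propositional.Properties using (∈-++⁺ˡ; ∈-++⁺ʳ; ∈-++⁻; ∈-filter⁺; ∈-filter⁻; ∈-allFin)
import Data.List.Membership.DecPropositional as DecMembership
open import Data.List.Relation.Unary.All as All using (All; []; _∷_)
import Data.List.Relation.Unary.All.Properties as All
open import Data.List.Relation.Unary.AllPairs as AllPairs using ([]; _∷_)
open import Data.List.Relation.Unary.Any using (here; there)
open import Data.List.Relation.Unary.Unique.Propositional using (Unique)
import Data.List.Relation.Unary.Unique.Propositional.Properties as Unique
open import Data.List.Relation.Binary.Permutation.Propositional
  using (_↭_; prep; swap; ↭-refl; ↭-sym; ↭-trans; ↭-reflexive; ↭⇒↭ₛ; module PermutationReasoning)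
import Data.List.Relation.Binary.Permutation.Propositional.Properties as Perm
import Data.List.Relation.Binary.Permutation.Setoid.Properties as PermSetoid
open import Data.Maybe using (just)
open import Data.Nat using (ℕ; zero; suc; _+_; _∸_; _≤_; _≤?_; z≤n; s≤s)
open import Data.Nat.Properties
open import Algebra.Properties.CommutativeSemigroup +-commutativeSemigroup using (interchange)
open import Data.Product using (∃-syntax; _×_; _,_; proj₁; proj₂)
open import Data.Sum using (_⊎_; inj₁; inj₂; [_,_]′) renaming (map to map⊎)
import Data.Unit as Unit
open import Data.Vec.Base using (_∷_; here; there)
import Data.Vec as Vec
import Data.Vec.Properties as Vec
open import Function.Base using (_∘_; case_of_)
open import Function.Bundles using (_⇔_; mk⇔; Equivalence)
open import Relation.Nullary using (¬_; Dec; yes; no; does)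
open import Relation.Nullary.Decidable using (dec-true; dec-false; _×-dec_; _⊎-dec_; _→-dec_)
open import Relation.Binary.PropositionalEquality
  using (_≡_; _≢_; refl; sym; trans; cong; cong₂; subst; setoid; module ≡-Reasoning)

module _ {a} {A : Set a} where

  Unique-resp-↭ : ∀ {xs ys : List A} → xs ↭ ys → Unique xs → Unique ys
  Unique-resp-↭ p = PermSetoid.Unique-resp-↭ (setoid A) (↭⇒↭ₛ p)

  Unique-++⁻ˡ : ∀ (xs : List A) {ys} → Unique (xs ++ ys) → Unique xs
  Unique-++⁻ˡ []       _          = []
  Unique-++⁻ˡ (x ∷ xs) (x∉ ∷ xs!) = All.++⁻ˡ xs x∉ ∷ Unique-++⁻ˡ xs xs!

  Unique-++⁻ʳ : ∀ (xs : List A) {ys} → Unique (xs ++ ys) → Unique ys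
  Unique-++⁻ʳ []       u         = u
  Unique-++⁻ʳ (x ∷ xs) (_ ∷ xs!) = Unique-++⁻ʳ xs xs!

  Unique-++⇒disjoint : ∀ (xs : List A) {ys z} → Unique (xs ++ ys) → z ∈ₗ xs → z ∈ₗ ys → Empty
  Unique-++⇒disjoint (x ∷ xs) (x∉ ∷ _)   (here refl) z∈ys = All.lookup (All.++⁻ʳ xs x∉) z∈ys refl
  Unique-++⇒disjoint (x ∷ xs) (_ ∷ xs!) (there z∈xs) z∈ys = Unique-++⇒disjoint xs xs! z∈xs z∈ys

  last≡just⇒∈ : ∀ (xs : List A) {y} → last xs ≡ just y → y ∈ₗ xs
  last≡just⇒∈ (x ∷ [])      refl = here refl
  last≡just⇒∈ (x ∷ x′ ∷ xs) eq   = there (last≡just⇒∈ (x′ ∷ xs) eq)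

  last-++-[_] : ∀ (xs : List A) y → last (xs ++ [ y ]) ≡ just y
  last-++-[_] []            y = refl
  last-++-[_] (x ∷ [])      y = refl
  last-++-[_] (x ∷ x′ ∷ xs) y = last-++-[_] (x′ ∷ xs) y

x∉p-x : ∀ {m} (p : Subset m) x → x ∉ p - x
x∉p-x (b ∷ p) zero    ()
x∉p-x (b ∷ p) (suc x) (there x∈p-x) = x∉p-x p x x∈p-x

x∈p⇒∣p∣≡1+∣p-x∣ : ∀ {m} {p : Subset m} {x} → x ∈ p → ∣ p ∣ ≡ suc ∣ p - x ∣
x∈p⇒∣p∣≡1+∣p-x∣ {p = inside ∷ p}  {zero}  here      = cong (λ q → suc ∣ q ∣) (sym (p─⊥≡p p))
x∈p⇒∣p∣≡1+∣p-x∣ {p = inside ∷ p}  {suc x} (there h) = cong suc (x∈p⇒∣p∣≡1+∣p-x∣ h)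
x∈p⇒∣p∣≡1+∣p-x∣ {p = outside ∷ p} {suc x} (there h) = x∈p⇒∣p∣≡1+∣p-x∣ h

∣p∣≡length : ∀ {m} (p : Subset m) {xs} → Unique xs → (∀ {i} → i ∈ p ⇔ i ∈ₗ xs) → ∣ p ∣ ≡ length xs
∣p∣≡length {m} p {[]} _ p⇔[] =
  trans (cong ∣_∣ (Empty-unique λ { (i , i∈p) → case Equivalence.to p⇔[] i∈p of λ () })) (∣⊥∣≡0 m)
∣p∣≡length p {x ∷ xs} (x∉xs ∷ xs!) p⇔x∷xs =
  trans (x∈p⇒∣p∣≡1+∣p-x∣ (Equivalence.from p⇔x∷xs (here refl))) (cong suc (∣p∣≡length (p - x) xs! p-x⇔xs))
  where
  p-x⇔xs : ∀ {i} → i ∈ p - x ⇔ i ∈ₗ xs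
  p-x⇔xs {i} = mk⇔ to from
    where
    to : i ∈ p - x → i ∈ₗ xs
    to i∈p-x with Equivalence.to p⇔x∷xs (p─q⊆p p _ i∈p-x)
    ... | here refl = ⊥-elim (x∉p-x p i i∈p-x)
    ... | there i∈xs = i∈xs
    from : i ∈ₗ xs → i ∈ p - x
    from i∈xs = x∈p∧x≢y⇒x∈p-y (Equivalence.from p⇔x∷xs (there i∈xs)) (λ { refl → All.lookup x∉xs i∈xs refl })

module _ {m : ℕ} where

  open DecMembership (_≟ᶠ_ {m}) using () renaming (_∈?_ to _∈ₗ?_)

  elements : Subset m → List (Fin m)
  elements p = filter (_∈? p) (allFin m)

  ∈⇔∈-elements : ∀ {p i} → i ∈ p ⇔ i ∈ₗ elements p
  ∈⇔∈-elements {p} {i} =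
    mk⇔ (∈-filter⁺ (_∈? p) (∈-allFin i)) (λ h → proj₂ (∈-filter⁻ (_∈? p) {xs = allFin m} h))

  elements-unique : ∀ p → Unique (elements p)
  elements-unique p = Unique.filter⁺ (_∈? p) (Unique.allFin⁺ m)

  ∣p∣≡length-elements : ∀ p → ∣ p ∣ ≡ length (elements p)
  ∣p∣≡length-elements p = ∣p∣≡length p (elements-unique p) ∈⇔∈-elements

  ∈-∪⇔∈-elements : ∀ {p q i} → i ∈ p ∪ q ⇔ i ∈ₗ elements p ++ elements q
  ∈-∪⇔∈-elements {p} {q} = mk⇔
    ([ ∈-++⁺ˡ ∘ Equivalence.to ∈⇔∈-elements , ∈-++⁺ʳ (elements p) ∘ Equivalence.to ∈⇔∈-elements ]′ ∘ x∈p∪q⁻ p q)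
    (x∈p∪q⁺ ∘ map⊎ (Equivalence.from ∈⇔∈-elements) (Equivalence.from ∈⇔∈-elements) ∘ ∈-++⁻ (elements p))

  fromList : List (Fin m) → Subset m
  fromList xs = Vec.tabulate (λ i → does (i ∈ₗ? xs))

  ∈-fromList⇔∈ : ∀ {xs i} → i ∈ fromList xs ⇔ i ∈ₗ xs
  ∈-fromList⇔∈ {xs} {i} = mk⇔ to from
    where
    lookup-fromList : Vec.lookup (fromList xs) i ≡ does (i ∈ₗ? xs)
    lookup-fromList = Vec.lookup∘tabulate (λ j → does (j ∈ₗ? xs)) i
    to : i ∈ fromList xs → i ∈ₗ xs
    to h with i ∈ₗ? xs | trans (sym lookup-fromList) (Vec.[]=⇒lookup h)
    ... | yes i∈xs | _ = i∈xs
    ... | no _     | ()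
    from : i ∈ₗ xs → i ∈ fromList xs
    from i∈xs = Vec.lookup⇒[]= i (fromList xs) (trans lookup-fromList (dec-true (i ∈ₗ? xs) i∈xs))

  ∣fromList∣≡length : ∀ {xs} → Unique xs → ∣ fromList xs ∣ ≡ length xs
  ∣fromList∣≡length xs! = ∣p∣≡length _ xs! ∈-fromList⇔∈

module Walks {n m : ℕ} (ends : Ends n m) where

  Step : Set
  Step = Fin m × Fin n

  Walk : Fin n → List Step → Set
  Walk = ValidWalk ends

  endpoint : Fin n → List Step → Fin n
  endpoint u []            = u
  endpoint u ((_ , v) ∷ st) = endpoint v st

  endpoint-∈ : ∀ u st → endpoint u st ∈ₗ u ∷ map proj₂ st
  endpoint-∈ u []            = here refl
  endpoint-∈ u ((_ , v) ∷ st) = there (endpoint-∈ v st)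

  last≡just⇒endpoint≡ : ∀ u st {w} → last (map proj₂ st) ≡ just w → endpoint u st ≡ w
  last≡just⇒endpoint≡ u ((_ , v) ∷ [])     refl = refl
  last≡just⇒endpoint≡ u ((_ , v) ∷ s ∷ st) eq   = last≡just⇒endpoint≡ v (s ∷ st) eq

  Walk-++ : ∀ u st st′ → Walk u st → Walk (endpoint u st) st′ → Walk u (st ++ st′)
  Walk-++ u []            st′ _         w′ = w′
  Walk-++ u ((e , v) ∷ st) st′ (uv , w) w′ = uv , Walk-++ v st st′ w w′

  Joins-sym : ∀ {e u v} → Joins ends e u v → Joins ends e v u
  Joins-sym (inj₁ eq) = inj₂ eq
  Joins-sym (inj₂ eq) = inj₁ eq

  Joins⇒Incidentˡ : ∀ {e u v} → Joins ends e u v → Incident ends e u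
  Joins⇒Incidentˡ (inj₁ eq) = inj₁ (cong proj₁ eq)
  Joins⇒Incidentˡ (inj₂ eq) = inj₂ (cong proj₂ eq)

  Joins⇒Incidentʳ : ∀ {e u v} → Joins ends e u v → Incident ends e v
  Joins⇒Incidentʳ = Joins⇒Incidentˡ ∘ Joins-sym

  Joins∧Incident⇒≡ : ∀ {e u v x} → Joins ends e u v → Incident ends e x → x ≡ u ⊎ x ≡ v
  Joins∧Incident⇒≡ (inj₁ eq) (inj₁ ex) = inj₁ (trans (sym ex) (cong proj₁ eq))
  Joins∧Incident⇒≡ (inj₁ eq) (inj₂ ex) = inj₂ (trans (sym ex) (cong proj₂ eq))
  Joins∧Incident⇒≡ (inj₂ eq) (inj₁ ex) = inj₂ (trans (sym ex) (cong proj₁ eq))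
  Joins∧Incident⇒≡ (inj₂ eq) (inj₂ ex) = inj₁ (trans (sym ex) (cong proj₂ eq))

  incident⇒∈walk : ∀ u st {f x} → Walk u st → f ∈ₗ map proj₁ st → Incident ends f x →
                   x ∈ₗ u ∷ map proj₂ st
  incident⇒∈walk u ((_ , v) ∷ st) (uv , _) (here refl) fx with Joins∧Incident⇒≡ uv fx
  ... | inj₁ refl = here refl
  ... | inj₂ refl = there (here refl)
  incident⇒∈walk u ((_ , v) ∷ st) (_ , w) (there f∈st) fx = there (incident⇒∈walk v st w f∈st fx)

  reverseOnto : Fin n → List Step → List Step → List Step
  reverseOnto u []             acc = acc
  reverseOnto u ((f , v) ∷ st) acc = reverseOnto v st ((f , u) ∷ acc)

  reverseWalk : Fin n → List Step → List Step
  reverseWalk u st = reverseOnto u st []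

  Walk-reverseOnto : ∀ u st acc → Walk u st → Walk u acc → Walk (endpoint u st) (reverseOnto u st acc)
  Walk-reverseOnto u []             acc _        a = a
  Walk-reverseOnto u ((f , v) ∷ st) acc (uv , w) a = Walk-reverseOnto v st ((f , u) ∷ acc) w (Joins-sym uv , a)

  endpoint-reverseOnto : ∀ u st acc → endpoint (endpoint u st) (reverseOnto u st acc) ≡ endpoint u acc
  endpoint-reverseOnto u []             acc = refl
  endpoint-reverseOnto u ((f , v) ∷ st) acc = endpoint-reverseOnto v st ((f , u) ∷ acc)

  vertices-reverseOnto : ∀ u st acc →
    endpoint u st ∷ map proj₂ (reverseOnto u st acc) ↭ u ∷ map proj₂ st ++ map proj₂ acc
  vertices-reverseOnto u []             acc = ↭-refl
  vertices-reverseOnto u ((f , v) ∷ st) acc = begin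
    endpoint v st ∷ map proj₂ (reverseOnto v st ((f , u) ∷ acc)) ↭⟨ vertices-reverseOnto v st ((f , u) ∷ acc) ⟩
    v ∷ map proj₂ st ++ u ∷ map proj₂ acc                        ↭⟨ prep v (Perm.shift u (map proj₂ st) _) ⟩
    v ∷ u ∷ map proj₂ st ++ map proj₂ acc                        ↭⟨ swap v u ↭-refl ⟩
    u ∷ v ∷ map proj₂ st ++ map proj₂ acc                        ∎
    where open PermutationReasoning

  edges-reverseOnto : ∀ u st acc → map proj₁ (reverseOnto u st acc) ↭ map proj₁ st ++ map proj₁ acc
  edges-reverseOnto u []             acc = ↭-refl
  edges-reverseOnto u ((f , v) ∷ st) acc =
    ↭-trans (edges-reverseOnto v st ((f , u) ∷ acc)) (Perm.shift f (map proj₁ st) (map proj₁ acc))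

  Walk-reverse : ∀ u st → Walk u st → Walk (endpoint u st) (reverseWalk u st)
  Walk-reverse u st w = Walk-reverseOnto u st [] w Unit.tt

  endpoint-reverse : ∀ u st → endpoint (endpoint u st) (reverseWalk u st) ≡ u
  endpoint-reverse u st = endpoint-reverseOnto u st []

  vertices-reverse : ∀ u st → endpoint u st ∷ map proj₂ (reverseWalk u st) ↭ u ∷ map proj₂ st
  vertices-reverse u st =
    subst (λ vs → endpoint u st ∷ map proj₂ (reverseWalk u st) ↭ u ∷ vs) (++-identityʳ (map proj₂ st)) (vertices-reverseOnto u st [])

  edges-reverse : ∀ u st → map proj₁ (reverseWalk u st) ↭ map proj₁ st
  edges-reverse u st = subst (map proj₁ (reverseWalk u st) ↭_) (++-identityʳ (map proj₁ st)) (edges-reverseOnto u st [])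

  TwoEdgesAt : List (Fin m) → Fin n → Set
  TwoEdgesAt es x = ∃[ f ] ∃[ g ] (f ≢ g × f ∈ₗ es × g ∈ₗ es × Incident ends f x × Incident ends g x)

  inner⇒TwoEdgesAt : ∀ u st {x} → Walk u st → Unique (map proj₁ st) → x ∈ₗ map proj₂ st →
                     x ≢ endpoint u st → TwoEdgesAt (map proj₁ st) x
  inner⇒TwoEdgesAt u ((f , v) ∷ []) _ _ (here refl) x≢end = ⊥-elim (x≢end refl)
  inner⇒TwoEdgesAt u ((f , v) ∷ (g , w) ∷ st) (uv , vw , _) ((f≢g ∷ _) ∷ _) (here refl) _ =
    f , g , f≢g , here refl , there (here refl) , Joins⇒Incidentʳ uv , Joins⇒Incidentˡ vw
  inner⇒TwoEdgesAt u ((f , v) ∷ st@(_ ∷ _)) (_ , w) (_ ∷ st!) (there x∈st) x≢end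
    with inner⇒TwoEdgesAt v st w st! x∈st x≢end
  ... | f′ , g′ , f′≢g′ , f′∈ , g′∈ , f′x , g′x = f′ , g′ , f′≢g′ , there f′∈ , there g′∈ , f′x , g′x

  AtMostOneEdgeAt : List (Fin m) → Fin n → Set
  AtMostOneEdgeAt es x = ∀ {f g} → f ∈ₗ es → g ∈ₗ es → Incident ends f x → Incident ends g x → f ≡ g

  TwoEdgesAt⇒¬AtMostOneEdgeAt : ∀ {es x} → TwoEdgesAt es x → ¬ AtMostOneEdgeAt es x
  TwoEdgesAt⇒¬AtMostOneEdgeAt (f , g , f≢g , f∈ , g∈ , fx , gx) atMostOne = f≢g (atMostOne f∈ g∈ fx gx)

  lastStep : Step → List Step → Step
  lastStep s []        = s
  lastStep _ (s ∷ st) = lastStep s st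

  lastStep-∈ : ∀ s st → proj₁ (lastStep s st) ∈ₗ map proj₁ (s ∷ st)
  lastStep-∈ s []        = here refl
  lastStep-∈ _ (s ∷ st) = there (lastStep-∈ s st)

  lastStep-incident : ∀ u s st → Walk u (s ∷ st) → Incident ends (proj₁ (lastStep s st)) (endpoint u (s ∷ st))
  lastStep-incident u (f , v) []        (uv , _) = Joins⇒Incidentʳ uv
  lastStep-incident u (f , v) (s ∷ st) (_ , w)   = lastStep-incident v s st w

vertices : ∀ {n m} → List (Comp n m) → List (Fin n)
vertices = concatMap compVerts

edges : ∀ {n m} → List (Comp n m) → List (Fin m)
edges = concatMap compEdges

isolated : ∀ {n m} → List (Fin n) → List (Comp n m)
isolated = map (λ v → path v [])

vertices-isolated : ∀ {n m} (vs : List (Fin n)) → vertices (isolated {m = m} vs) ≡ vs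
vertices-isolated []       = refl
vertices-isolated (v ∷ vs) = cong (v ∷_) (vertices-isolated vs)

edges-isolated : ∀ {n m} (vs : List (Fin n)) → edges (isolated {m = m} vs) ≡ []
edges-isolated []       = refl
edges-isolated (v ∷ vs) = edges-isolated vs

length-compVerts : ∀ {n m} (c : Comp n m) → length (compVerts c) ≡ isPath c + length (compEdges c)
length-compVerts (path v st)  = cong suc (trans (length-map proj₂ st) (sym (length-map proj₁ st)))
length-compVerts (cycle v st) = trans (length-map proj₂ st) (sym (length-map proj₁ st))

length-vertices : ∀ {n m} (D : List (Comp n m)) → length (vertices D) ≡ pathCount D + length (edges D)
length-vertices []      = refl
length-vertices (c ∷ D) = begin
  length (compVerts c ++ vertices D)                                  ≡⟨ length-++ (compVerts c) ⟩
  length (compVerts c) + length (vertices D)                          ≡⟨ cong₂ _+_ (length-compVerts c) (length-vertices D) ⟩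
  (isPath c + length (compEdges c)) + (pathCount D + length (edges D)) ≡⟨ interchange (isPath c) _ _ _ ⟩
  (isPath c + pathCount D) + (length (compEdges c) + length (edges D)) ≡⟨ cong (isPath c + pathCount D +_) (length-++ (compEdges c)) ⟨
  pathCount (c ∷ D) + length (edges (c ∷ D))                          ∎
  where open ≡-Reasoning

pathCount+#edges≡n : ∀ {n m} (ends : Ends n m) {E′ D} → IsPecDecomposition ends E′ D →
                     pathCount D + length (edges D) ≡ n
pathCount+#edges≡n {n} ends {D = D} (_ , vertices↭ , _) =
  trans (sym (length-vertices D)) (trans (Perm.↭-length vertices↭) (length-tabulate (λ x → x)))

module PathEnds {n m : ℕ} (ends : Ends n m) where

  open Walks ends

  record PathEndingAt (D : List (Comp n m)) (a : Fin n) : Set where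
    constructor pathEndingAt
    field
      start      : Fin n
      steps      : List Step
      rest       : List (Comp n m)
      walk       : Walk start steps
      reaches    : endpoint start steps ≡ a
      rest-valid : All (ValidComp ends) rest
      vertices-↭ : (start ∷ map proj₂ steps) ++ vertices rest ↭ vertices D
      edges-↭    : map proj₁ steps ++ edges rest ↭ edges D

  -- Inner vertices of paths and all vertices of cycles have degree two; a path is reversed when
  -- the vertex is its start.
  endOfComponent : ∀ c D {a} → ValidComp ends c → All (ValidComp ends) D → Unique (compEdges c) →
                   a ∈ₗ compVerts c → AtMostOneEdgeAt (compEdges c) a → PathEndingAt (c ∷ D) a
  endOfComponent (path v st) D {a} w D-valid st! a∈c atMostOne with a ≟ᶠ endpoint v st | a ≟ᶠ v | a∈c
  ... | yes refl | _        | _ = pathEndingAt v st D w refl D-valid ↭-refl ↭-refl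
  ... | no _     | yes refl | _ =
    pathEndingAt (endpoint a st) (reverseWalk a st) D (Walk-reverse a st w) (endpoint-reverse a st) D-valid
      (Perm.++⁺ʳ (vertices D) (vertices-reverse a st)) (Perm.++⁺ʳ (edges D) (edges-reverse a st))
  ... | no _     | no a≢v   | here a≡v  = ⊥-elim (a≢v a≡v)
  ... | no a≢end | no _     | there a∈st =
    ⊥-elim (TwoEdgesAt⇒¬AtMostOneEdgeAt (inner⇒TwoEdgesAt v st w st! a∈st a≢end) atMostOne)
  endOfComponent (cycle v st) D {a} (w , lst , _ , _) _ st! a∈c atMostOne with a ≟ᶠ endpoint v st
  ... | no a≢end =
    ⊥-elim (TwoEdgesAt⇒¬AtMostOneEdgeAt (inner⇒TwoEdgesAt v st w st! a∈c a≢end) atMostOne)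
  endOfComponent (cycle v ((f , v₁) ∷ [])) D (_ , _ , () , _) _ _ _ _ | yes _
  endOfComponent (cycle v ((f , v₁) ∷ s ∷ st)) D {a} ((vv₁ , w) , lst , _ , _) _ (f∉ ∷ _) _ atMostOne
    | yes a≡end = ⊥-elim (All.lookup f∉ (lastStep-∈ s st) (atMostOne (here refl) (there (lastStep-∈ s st)) fa ga))
    where
    a≡v : a ≡ v
    a≡v = trans a≡end (last≡just⇒endpoint≡ v ((f , v₁) ∷ s ∷ st) lst)
    fa : Incident ends f a
    fa = subst (Incident ends f) (sym a≡v) (Joins⇒Incidentˡ vv₁)
    ga : Incident ends (proj₁ (lastStep s st)) a
    ga = subst (Incident ends _) (sym a≡end) (lastStep-incident v₁ s st w)

  endOfPath : ∀ D {a} → All (ValidComp ends) D → Unique (edges D) → a ∈ₗ vertices D →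
              AtMostOneEdgeAt (edges D) a → PathEndingAt D a
  endOfPath (c ∷ D) (c-valid ∷ D-valid) c∷D! a∈ atMostOne with ∈-++⁻ (compVerts c) a∈
  ... | inj₁ a∈c = endOfComponent c D c-valid D-valid (Unique-++⁻ˡ (compEdges c) c∷D!) a∈c
                     (λ f∈ g∈ → atMostOne (∈-++⁺ˡ f∈) (∈-++⁺ˡ g∈))
  ... | inj₂ a∈D with endOfPath D D-valid (Unique-++⁻ʳ (compEdges c) c∷D!) a∈D
                        (λ f∈ g∈ → atMostOne (∈-++⁺ʳ (compEdges c) f∈) (∈-++⁺ʳ (compEdges c) g∈))
  ...   | pathEndingAt v st rest w reaches rest-valid vs↭ es↭ =
    pathEndingAt v st (c ∷ rest) w reaches (c-valid ∷ rest-valid)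
      (↭-trans (Perm.shifts (v ∷ map proj₂ st) (compVerts c)) (Perm.++⁺ˡ (compVerts c) vs↭))
      (↭-trans (Perm.shifts (map proj₁ st) (compEdges c)) (Perm.++⁺ˡ (compEdges c) es↭))

flips : ℕ → Bool → Bool
flips zero    b = b
flips (suc k) b = not (flips k b)

flips-not : ∀ k b → flips k (not b) ≡ not (flips k b)
flips-not zero    b = refl
flips-not (suc k) b = cong not (flips-not k b)

flips-fixed⇒Even : ∀ k b → flips k b ≡ b → Even k
flips-fixed⇒Even zero          b _  = even0
flips-fixed⇒Even (suc zero)    b eq = ⊥-elim (not-¬ refl (sym eq))
flips-fixed⇒Even (suc (suc k)) b eq =
  evenSS (flips-fixed⇒Even k b (trans (sym (not-involutive (flips k b))) eq))

module FromMatchings {n m : ℕ} (ends : Ends n m) (loopless : Loopless ends)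
                     {F H H′ : Subset m} (HH′ : DisjointMatchings ends F H H′) where

  open Walks ends
  open PathEnds ends

  private
    H-matching : ∀ e f v → e ∈ H → f ∈ H → Incident ends e v → Incident ends f v → e ≡ f
    H-matching = proj₂ (proj₁ HH′)
    H′-matching : ∀ e f v → e ∈ H′ → f ∈ H′ → Incident ends e v → Incident ends f v → e ≡ f
    H′-matching = proj₂ (proj₁ (proj₂ HH′))
    H∩H′≡∅ : ∀ e → e ∈ H → e ∉ H′
    H∩H′≡∅ = proj₂ (proj₂ HH′)

  Coloured : Fin m → Set
  Coloured f = f ∈ H ⊎ f ∈ H′

  colour : Fin m → Bool
  colour f = does (f ∈? H)

  three-coloured-edges-at : ∀ {f g e v} → Coloured f → Coloured g → Coloured e →
    Incident ends f v → Incident ends g v → Incident ends e v → f ≡ g ⊎ f ≡ e ⊎ g ≡ e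
  three-coloured-edges-at (inj₁ f∈) (inj₁ g∈) _          fv gv ev = inj₁ (H-matching _ _ _ f∈ g∈ fv gv)
  three-coloured-edges-at (inj₂ f∈) (inj₂ g∈) _          fv gv ev = inj₁ (H′-matching _ _ _ f∈ g∈ fv gv)
  three-coloured-edges-at (inj₁ f∈) (inj₂ g∈) (inj₁ e∈) fv gv ev = inj₂ (inj₁ (H-matching _ _ _ f∈ e∈ fv ev))
  three-coloured-edges-at (inj₁ f∈) (inj₂ g∈) (inj₂ e∈) fv gv ev = inj₂ (inj₂ (H′-matching _ _ _ g∈ e∈ gv ev))
  three-coloured-edges-at (inj₂ f∈) (inj₁ g∈) (inj₁ e∈) fv gv ev = inj₂ (inj₂ (H-matching _ _ _ g∈ e∈ gv ev))
  three-coloured-edges-at (inj₂ f∈) (inj₁ g∈) (inj₂ e∈) fv gv ev = inj₂ (inj₁ (H′-matching _ _ _ f∈ e∈ fv ev))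

  colour-alternates : ∀ {f g v} → Coloured f → Coloured g → f ≢ g →
                      Incident ends f v → Incident ends g v → colour f ≡ not (colour g)
  colour-alternates (inj₁ f∈) (inj₁ g∈) f≢g fv gv = ⊥-elim (f≢g (H-matching _ _ _ f∈ g∈ fv gv))
  colour-alternates (inj₂ f∈) (inj₂ g∈) f≢g fv gv = ⊥-elim (f≢g (H′-matching _ _ _ f∈ g∈ fv gv))
  colour-alternates {f} {g} (inj₁ f∈) (inj₂ g∈) _ _ _ =
    trans (dec-true (f ∈? H) f∈) (cong not (sym (dec-false (g ∈? H) (λ g∈H → H∩H′≡∅ g g∈H g∈))))
  colour-alternates {f} {g} (inj₂ f∈) (inj₁ g∈) _ _ _ =
    trans (dec-false (f ∈? H) (λ f∈H → H∩H′≡∅ f f∈H f∈)) (cong not (sym (dec-true (g ∈? H) g∈)))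

  colour-lastStep : ∀ u s st → Walk u (s ∷ st) → Unique (map proj₁ (s ∷ st)) →
                    All Coloured (map proj₁ (s ∷ st)) →
                    colour (proj₁ (lastStep s st)) ≡ flips (length st) (colour (proj₁ s))
  colour-lastStep u s []              _            _               _               = refl
  colour-lastStep u (f , v) ((g , w) ∷ st) (uv , vw , walk) ((f≢g ∷ _) ∷ g∷st!) (f-col ∷ g∷st-col) = begin
    colour (proj₁ (lastStep (g , w) st)) ≡⟨ colour-lastStep v (g , w) st (vw , walk) g∷st! g∷st-col ⟩
    flips (length st) (colour g)         ≡⟨ cong (flips (length st)) g≡¬f ⟩
    flips (length st) (not (colour f))   ≡⟨ flips-not (length st) (colour f) ⟩
    not (flips (length st) (colour f))   ∎
    where
    open ≡-Reasoning
    g≡¬f : colour g ≡ not (colour f)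
    g≡¬f = colour-alternates (All.head g∷st-col) f-col (f≢g ∘ sym) (Joins⇒Incidentˡ vw) (Joins⇒Incidentʳ uv)

  -- The colours alternate along the walk, and its first and last edges both differ in colour from e.
  closing-edge⇒Even : ∀ u s st {e} → Walk u (s ∷ st) → Unique (map proj₁ (s ∷ st)) →
    All Coloured (map proj₁ (s ∷ st)) → Coloured e → All (_≢ e) (map proj₁ (s ∷ st)) →
    Incident ends e u → Incident ends e (endpoint u (s ∷ st)) → Even (length st)
  closing-edge⇒Even u (f , v) st {e} walk st! st-col e-col st≢e eu eend =
    flips-fixed⇒Even (length st) (colour f) (begin
      flips (length st) (colour f)  ≡⟨ colour-lastStep u (f , v) st walk st! st-col ⟨
      colour (proj₁ (lastStep (f , v) st)) ≡⟨ colour-alternates (All.lookup st-col last∈) e-col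
                                                (All.lookup st≢e last∈) (lastStep-incident u (f , v) st walk) eend ⟩
      not (colour e)                ≡⟨ colour-alternates (All.head st-col) e-col (All.head st≢e)
                                         (Joins⇒Incidentˡ (proj₁ walk)) eu ⟨
      colour f                      ∎)
    where
    open ≡-Reasoning
    last∈ : proj₁ (lastStep (f , v) st) ∈ₗ map proj₁ ((f , v) ∷ st)
    last∈ = lastStep-∈ (f , v) st

  PecOf : List (Fin m) → List (Comp n m) → Set
  PecOf L D = All (ValidComp ends) D × vertices D ↭ allFin n × edges D ↭ L

  -- Both ends of a new edge have degree at most one, so each is the end of a path: the edge
  -- either closes a path into a cycle, which is even by alternation, or joins two paths.
  module Insert (e : Fin m) {L D} (D-pec : PecOf L D) (e∷L! : Unique (e ∷ L)) (e∷L-col : All Coloured (e ∷ L)) where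

    open PathEndingAt

    a b : Fin n
    a = proj₁ (ends e)
    b = proj₂ (ends e)

    private
      D-valid : All (ValidComp ends) D
      D-valid = proj₁ D-pec
      D-vertices : vertices D ↭ allFin n
      D-vertices = proj₁ (proj₂ D-pec)
      D-edges : edges D ↭ L
      D-edges = proj₂ (proj₂ D-pec)

    D! : Unique (edges D)
    D! = Unique-resp-↭ (↭-sym D-edges) (AllPairs.tail e∷L!)

    ∈D⇒coloured : ∀ {f} → f ∈ₗ edges D → Coloured f
    ∈D⇒coloured f∈ = All.lookup (All.tail e∷L-col) (Perm.∈-resp-↭ D-edges f∈)

    ∈D⇒≢e : ∀ {f} → f ∈ₗ edges D → f ≢ e
    ∈D⇒≢e f∈ refl = All.lookup (AllPairs.head e∷L!) (Perm.∈-resp-↭ D-edges f∈) refl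

    ∈vertices : ∀ x → x ∈ₗ vertices D
    ∈vertices x = Perm.∈-resp-↭ (↭-sym D-vertices) (∈-allFin x)

    atMostOneEdgeAt-ends : ∀ {x} → Incident ends e x → AtMostOneEdgeAt (edges D) x
    atMostOneEdgeAt-ends ex f∈ g∈ fx gx
      with three-coloured-edges-at (∈D⇒coloured f∈) (∈D⇒coloured g∈) (All.head e∷L-col) fx gx ex
    ... | inj₁ f≡g        = f≡g
    ... | inj₂ (inj₁ f≡e) = ⊥-elim (∈D⇒≢e f∈ f≡e)
    ... | inj₂ (inj₂ g≡e) = ⊥-elim (∈D⇒≢e g∈ g≡e)

    a≢b : a ≢ b
    a≢b = loopless e

    module _ (P : PathEndingAt D a) where

      steps⊆D : ∀ {f} → f ∈ₗ map proj₁ (steps P) → f ∈ₗ edges D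
      steps⊆D f∈ = Perm.∈-resp-↭ (edges-↭ P) (∈-++⁺ˡ f∈)

      rest⊆D : ∀ {f} → f ∈ₗ edges (rest P) → f ∈ₗ edges D
      rest⊆D f∈ = Perm.∈-resp-↭ (edges-↭ P) (∈-++⁺ʳ (map proj₁ (steps P)) f∈)

      steps++rest! : Unique (map proj₁ (steps P) ++ edges (rest P))
      steps++rest! = Unique-resp-↭ (↭-sym (edges-↭ P)) D!

      steps! : Unique (map proj₁ (steps P))
      steps! = Unique-++⁻ˡ (map proj₁ (steps P)) steps++rest!

      b∉inner : ¬ b ∈ₗ map proj₂ (steps P)
      b∉inner b∈ with b ≟ᶠ endpoint (start P) (steps P)
      ... | yes b≡end = a≢b (trans (sym (reaches P)) (sym b≡end))
      ... | no b≢end  = TwoEdgesAt⇒¬AtMostOneEdgeAt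
              (inner⇒TwoEdgesAt (start P) (steps P) (walk P) steps! b∈ b≢end)
              (λ f∈ g∈ → atMostOneEdgeAt-ends (inj₂ refl) (steps⊆D f∈) (steps⊆D g∈))

      locate-b : b ≡ start P ⊎ b ∈ₗ vertices (rest P)
      locate-b with ∈-++⁻ (start P ∷ map proj₂ (steps P)) (Perm.∈-resp-↭ (↭-sym (vertices-↭ P)) (∈vertices b))
      ... | inj₁ (here b≡start) = inj₁ b≡start
      ... | inj₁ (there b∈)     = ⊥-elim (b∉inner b∈)
      ... | inj₂ b∈rest         = inj₂ b∈rest

    close : (P : PathEndingAt D a) → b ≡ start P → ∃[ D′ ] PecOf (e ∷ L) D′
    close (pathEndingAt v [] _ _ v≡a _ _ _) b≡v = ⊥-elim (a≢b (trans (sym v≡a) (sym b≡v)))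
    close P@(pathEndingAt v st@((f , v₁) ∷ st₀) rest w reaches rest-valid vs↭ es↭) b≡v =
      cycle v (st ++ [ (e , v) ]) ∷ rest , (cycle-valid ∷ rest-valid) , vs , es
      where
      open PermutationReasoning
      cycle-even : Even (length (st ++ [ (e , v) ]))
      cycle-even = subst Even (sym (trans (length-++ st) (+-comm (length st) 1)))
        (evenSS (closing-edge⇒Even v (f , v₁) st₀ w (steps! P)
          (All.tabulate (λ f∈ → ∈D⇒coloured (steps⊆D P f∈))) (All.head e∷L-col)
          (All.tabulate (λ f∈ → ∈D⇒≢e (steps⊆D P f∈)))
          (subst (Incident ends e) b≡v (inj₂ refl)) (subst (Incident ends e) (sym reaches) (inj₁ refl))))
      cycle-valid : ValidComp ends (cycle v (st ++ [ (e , v) ]))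
      cycle-valid = Walk-++ v st [ (e , v) ] w (inj₁ (cong₂ _,_ (sym reaches) b≡v) , Unit.tt)
                  , trans (cong last (map-++ proj₂ st [ (e , v) ])) (last-++-[ map proj₂ st ] v)
                  , cycle-even , s≤s z≤n
      vs : vertices (cycle v (st ++ [ (e , v) ]) ∷ rest) ↭ allFin n
      vs = begin
        map proj₂ (st ++ [ (e , v) ]) ++ vertices rest ≡⟨ cong (_++ vertices rest) (map-++ proj₂ st _) ⟩
        (map proj₂ st ++ [ v ]) ++ vertices rest       ↭⟨ Perm.++⁺ʳ (vertices rest) (↭-sym (Perm.∷↭∷ʳ v (map proj₂ st))) ⟩
        (v ∷ map proj₂ st) ++ vertices rest            ↭⟨ vs↭ ⟩
        vertices D                                     ↭⟨ D-vertices ⟩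
        allFin n                                       ∎
      es : edges (cycle v (st ++ [ (e , v) ]) ∷ rest) ↭ e ∷ L
      es = begin
        map proj₁ (st ++ [ (e , v) ]) ++ edges rest ≡⟨ cong (_++ edges rest) (map-++ proj₁ st _) ⟩
        (map proj₁ st ++ [ e ]) ++ edges rest       ≡⟨ ++-assoc (map proj₁ st) [ e ] (edges rest) ⟩
        map proj₁ st ++ [ e ] ++ edges rest         ↭⟨ Perm.shift e (map proj₁ st) (edges rest) ⟩
        e ∷ map proj₁ st ++ edges rest              ↭⟨ prep e (↭-trans es↭ D-edges) ⟩
        e ∷ L                                       ∎

    join : (P : PathEndingAt D a) → b ∈ₗ vertices (rest P) → ∃[ D′ ] PecOf (e ∷ L) D′
    join P@(pathEndingAt v st rest w reaches rest-valid vs↭ es↭) b∈rest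
      with endOfPath rest rest-valid (Unique-++⁻ʳ (map proj₁ st) (steps++rest! P)) b∈rest
             (λ f∈ g∈ → atMostOneEdgeAt-ends (inj₂ refl) (rest⊆D P f∈) (rest⊆D P g∈))
    ... | pathEndingAt u st′ rest′ w′ reaches′ rest′-valid vs↭′ es↭′ =
      path v (st ++ (e , b) ∷ R) ∷ rest′ , (path-valid ∷ rest′-valid) , vs , es
      where
      open PermutationReasoning
      R : List Step
      R = reverseWalk u st′
      R-walk : Walk b R
      R-walk = subst (λ x → Walk x R) reaches′ (Walk-reverse u st′ w′)
      R-vertices : b ∷ map proj₂ R ↭ u ∷ map proj₂ st′
      R-vertices = subst (λ x → x ∷ map proj₂ R ↭ u ∷ map proj₂ st′) reaches′ (vertices-reverse u st′)
      path-valid : Walk v (st ++ (e , b) ∷ R)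
      path-valid = Walk-++ v st ((e , b) ∷ R) w (inj₁ (cong (_, b) (sym reaches)) , R-walk)
      vs : vertices (path v (st ++ (e , b) ∷ R) ∷ rest′) ↭ allFin n
      vs = begin
        v ∷ map proj₂ (st ++ (e , b) ∷ R) ++ vertices rest′ ≡⟨ cong (λ xs → v ∷ xs ++ vertices rest′) (map-++ proj₂ st _) ⟩
        v ∷ (map proj₂ st ++ b ∷ map proj₂ R) ++ vertices rest′ ≡⟨ cong (v ∷_) (++-assoc (map proj₂ st) _ _) ⟩
        (v ∷ map proj₂ st) ++ (b ∷ map proj₂ R) ++ vertices rest′
          ↭⟨ Perm.++⁺ˡ (v ∷ map proj₂ st) (Perm.++⁺ʳ (vertices rest′) R-vertices) ⟩
        (v ∷ map proj₂ st) ++ (u ∷ map proj₂ st′) ++ vertices rest′ ↭⟨ Perm.++⁺ˡ (v ∷ map proj₂ st) vs↭′ ⟩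
        (v ∷ map proj₂ st) ++ vertices rest ↭⟨ vs↭ ⟩
        vertices D                          ↭⟨ D-vertices ⟩
        allFin n                            ∎
      es : edges (path v (st ++ (e , b) ∷ R) ∷ rest′) ↭ e ∷ L
      es = begin
        map proj₁ (st ++ (e , b) ∷ R) ++ edges rest′    ≡⟨ cong (_++ edges rest′) (map-++ proj₁ st _) ⟩
        (map proj₁ st ++ e ∷ map proj₁ R) ++ edges rest′ ≡⟨ ++-assoc (map proj₁ st) _ _ ⟩
        map proj₁ st ++ [ e ] ++ map proj₁ R ++ edges rest′ ↭⟨ Perm.shift e (map proj₁ st) _ ⟩
        e ∷ map proj₁ st ++ map proj₁ R ++ edges rest′
          ↭⟨ prep e (Perm.++⁺ˡ (map proj₁ st) (Perm.++⁺ʳ (edges rest′) (edges-reverse u st′))) ⟩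
        e ∷ map proj₁ st ++ map proj₁ st′ ++ edges rest′ ↭⟨ prep e (Perm.++⁺ˡ (map proj₁ st) es↭′) ⟩
        e ∷ map proj₁ st ++ edges rest                  ↭⟨ prep e (↭-trans es↭ D-edges) ⟩
        e ∷ L                                           ∎

    insert : ∃[ D′ ] PecOf (e ∷ L) D′
    insert = [ close P , join P ]′ (locate-b P)
      where
      P : PathEndingAt D a
      P = endOfPath D D-valid D! (∈vertices a) (atMostOneEdgeAt-ends (inj₁ refl))

  pecOf : ∀ L → Unique L → All Coloured L → ∃[ D ] PecOf L D
  pecOf []      _      _          =
    isolated (allFin n) , All.map⁺ (All.universal (λ _ → Unit.tt) (allFin n))
    , ↭-reflexive (vertices-isolated (allFin n)) , ↭-reflexive (edges-isolated (allFin n))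
  pecOf (e ∷ L) e∷L! e∷L-col =
    Insert.insert e (proj₂ (pecOf L (AllPairs.tail e∷L!) (All.tail e∷L-col))) e∷L! e∷L-col

pecDecomposition-of-matchings : ∀ {n m} (ends : Ends n m) → Loopless ends → ∀ {F H H′} →
  DisjointMatchings ends F H H′ →
  ∃[ D ] (IsPecDecomposition ends (H ∪ H′) D × pathCount D + (∣ H ∣ + ∣ H′ ∣) ≡ n)
pecDecomposition-of-matchings {n} ends loopless {H = H} {H′} HH′ = D , D-pec , count
  where
  open FromMatchings ends loopless HH′ using (Coloured; PecOf; pecOf)
  L : List _
  L = elements H ++ elements H′
  L! : Unique L
  L! = Unique.++⁺ (elements-unique H) (elements-unique H′) λ { (e∈H , e∈H′) →
         proj₂ (proj₂ HH′) _ (Equivalence.from ∈⇔∈-elements e∈H) (Equivalence.from ∈⇔∈-elements e∈H′) }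
  built : ∃[ D ] PecOf L D
  built = pecOf L L! (All.tabulate (x∈p∪q⁻ H H′ ∘ Equivalence.from ∈-∪⇔∈-elements))
  D : List (Comp _ _)
  D = proj₁ built
  D-pecOf : PecOf L D
  D-pecOf = proj₂ built
  D-edges : edges D ↭ L
  D-edges = proj₂ (proj₂ D-pecOf)
  D-pec : IsPecDecomposition ends (H ∪ H′) D
  D-pec = proj₁ D-pecOf , proj₁ (proj₂ D-pecOf) , Unique-resp-↭ (↭-sym D-edges) L!
        , λ e → mk⇔ (Perm.∈-resp-↭ (↭-sym D-edges) ∘ Equivalence.to ∈-∪⇔∈-elements)
                    (Equivalence.from ∈-∪⇔∈-elements ∘ Perm.∈-resp-↭ D-edges)
  count : pathCount D + (∣ H ∣ + ∣ H′ ∣) ≡ n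
  count = begin
    pathCount D + (∣ H ∣ + ∣ H′ ∣)                               ≡⟨ cong (pathCount D +_) (cong₂ _+_ (∣p∣≡length-elements H) (∣p∣≡length-elements H′)) ⟩
    pathCount D + (length (elements H) + length (elements H′)) ≡⟨ cong (pathCount D +_) (length-++ (elements H)) ⟨
    pathCount D + length L                                     ≡⟨ cong (pathCount D +_) (Perm.↭-length D-edges) ⟨
    pathCount D + length (edges D)                             ≡⟨ pathCount+#edges≡n ends D-pec ⟩
    n                                                          ∎
    where open ≡-Reasoning

module _ {a} {A : Set a} where

  mutual
    odds : List A → List A
    odds []       = []
    odds (x ∷ xs) = x ∷ evens xs

    evens : List A → List A
    evens []       = []
    evens (_ ∷ xs) = odds xs

  odds++evens↭ : ∀ (xs : List A) → odds xs ++ evens xs ↭ xs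
  odds++evens↭ []       = ↭-refl
  odds++evens↭ (x ∷ xs) = prep x (↭-trans (Perm.++-comm (evens xs) (odds xs)) (odds++evens↭ xs))

  odds-⊆ : ∀ (xs : List A) {y} → y ∈ₗ odds xs → y ∈ₗ xs
  odds-⊆ xs y∈ = Perm.∈-resp-↭ (odds++evens↭ xs) (∈-++⁺ˡ y∈)

  evens-⊆ : ∀ (xs : List A) {y} → y ∈ₗ evens xs → y ∈ₗ xs
  evens-⊆ xs y∈ = Perm.∈-resp-↭ (odds++evens↭ xs) (∈-++⁺ʳ (odds xs) y∈)

oddEdges evenEdges : ∀ {n m} → List (Comp n m) → List (Fin m)
oddEdges  = concatMap (odds ∘ compEdges)
evenEdges = concatMap (evens ∘ compEdges)

oddEdges++evenEdges↭ : ∀ {n m} (D : List (Comp n m)) → oddEdges D ++ evenEdges D ↭ edges D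
oddEdges++evenEdges↭ []      = ↭-refl
oddEdges++evenEdges↭ (c ∷ D) = begin
  (odds cs ++ oddEdges D) ++ evens cs ++ evenEdges D ≡⟨ ++-assoc (odds cs) _ _ ⟩
  odds cs ++ oddEdges D ++ evens cs ++ evenEdges D   ↭⟨ Perm.++⁺ˡ (odds cs) (Perm.shifts (oddEdges D) (evens cs)) ⟩
  odds cs ++ evens cs ++ oddEdges D ++ evenEdges D   ≡⟨ ++-assoc (odds cs) _ _ ⟨
  (odds cs ++ evens cs) ++ oddEdges D ++ evenEdges D ↭⟨ Perm.++⁺ (odds++evens↭ cs) (oddEdges++evenEdges↭ D) ⟩
  cs ++ edges D                                      ∎
  where
  open PermutationReasoning
  cs : List _
  cs = compEdges c

oddEdges-⊆ : ∀ {n m} (D : List (Comp n m)) {f} → f ∈ₗ oddEdges D → f ∈ₗ edges D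
oddEdges-⊆ D f∈ = Perm.∈-resp-↭ (oddEdges++evenEdges↭ D) (∈-++⁺ˡ f∈)

evenEdges-⊆ : ∀ {n m} (D : List (Comp n m)) {f} → f ∈ₗ evenEdges D → f ∈ₗ edges D
evenEdges-⊆ D f∈ = Perm.∈-resp-↭ (oddEdges++evenEdges↭ D) (∈-++⁺ʳ (oddEdges D) f∈)

module ToMatchings {n m : ℕ} (ends : Ends n m) where

  open Walks ends

  IsMatching : List (Fin m) → Set
  IsMatching es = ∀ x → AtMostOneEdgeAt es x

  IsMatching-[_] : ∀ f → IsMatching [ f ]
  IsMatching-[_] f x (here refl) (here refl) _ _ = refl

  IsMatching-++ : ∀ {xs ys} → IsMatching xs → IsMatching ys →
    (∀ {f g x} → f ∈ₗ xs → g ∈ₗ ys → Incident ends f x → Incident ends g x → Empty) →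
    IsMatching (xs ++ ys)
  IsMatching-++ {xs} xs-matching ys-matching apart x f∈ g∈ fx gx with ∈-++⁻ xs f∈ | ∈-++⁻ xs g∈
  ... | inj₁ f∈xs | inj₁ g∈xs = xs-matching x f∈xs g∈xs fx gx
  ... | inj₁ f∈xs | inj₂ g∈ys = ⊥-elim (apart f∈xs g∈ys fx gx)
  ... | inj₂ f∈ys | inj₁ g∈xs = ⊥-elim (apart g∈xs f∈ys gx fx)
  ... | inj₂ f∈ys | inj₂ g∈ys = ys-matching x f∈ys g∈ys fx gx

  incident⇒∈compVerts : ∀ c {f x} → ValidComp ends c → f ∈ₗ compEdges c → Incident ends f x → x ∈ₗ compVerts c
  incident⇒∈compVerts (path v st)  walk            f∈ fx = incident⇒∈walk v st walk f∈ fx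
  incident⇒∈compVerts (cycle v st) (walk , lst , _) f∈ fx with incident⇒∈walk v st walk f∈ fx
  ... | here refl = last≡just⇒∈ (map proj₂ st) lst
  ... | there x∈  = x∈

  incident⇒∈vertices : ∀ D {f x} → All (ValidComp ends) D → f ∈ₗ edges D → Incident ends f x → x ∈ₗ vertices D
  incident⇒∈vertices (c ∷ D) (c-valid ∷ D-valid) f∈ fx with ∈-++⁻ (compEdges c) f∈
  ... | inj₁ f∈c = ∈-++⁺ˡ (incident⇒∈compVerts c c-valid f∈c fx)
  ... | inj₂ f∈D = ∈-++⁺ʳ (compVerts c) (incident⇒∈vertices D D-valid f∈D fx)

  evens-incident⇒∈ : ∀ u st {g x} → Walk u st → g ∈ₗ evens (map proj₁ st) → Incident ends g x →
                     x ∈ₗ map proj₂ st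
  evens-incident⇒∈ u ((_ , w) ∷ st) (_ , walk) g∈ gx = incident⇒∈walk w st walk (odds-⊆ (map proj₁ st) g∈) gx

  odds-avoid-endpoint : ∀ u st {g x} → Walk u st → Unique (u ∷ map proj₂ st) → Even (length st) →
                        g ∈ₗ odds (map proj₁ st) → Incident ends g x → x ≢ endpoint u st
  odds-avoid-endpoint u ((_ , v) ∷ (_ , w) ∷ st) (uv , _) ((_ ∷ u∉) ∷ v∉ ∷ _) _ (here refl) gx
    with Joins∧Incident⇒≡ uv gx
  ... | inj₁ refl = All.lookup u∉ (endpoint-∈ w st)
  ... | inj₂ refl = All.lookup v∉ (endpoint-∈ w st)
  odds-avoid-endpoint u ((_ , v) ∷ (_ , w) ∷ st) (_ , _ , walk) (_ ∷ _ ∷ w∷st!) (evenSS st-even) (there g∈) gx =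
    odds-avoid-endpoint w st walk w∷st! st-even g∈ gx

  walk-matchings : ∀ u st → Walk u st → Unique (u ∷ map proj₂ st) →
                   IsMatching (odds (map proj₁ st)) × IsMatching (evens (map proj₁ st))
  walk-matchings u []             _           _               = (λ _ ()) , (λ _ ())
  walk-matchings u ((f , w) ∷ st) (uw , walk) (u∉ ∷ w∷st!@(w∉ ∷ _)) =
    IsMatching-++ IsMatching-[ f ] (proj₂ rec) apart , proj₁ rec
    where
    rec : IsMatching (odds (map proj₁ st)) × IsMatching (evens (map proj₁ st))
    rec = walk-matchings w st walk w∷st!
    apart : ∀ {f′ g x} → f′ ∈ₗ [ f ] → g ∈ₗ evens (map proj₁ st) → Incident ends f′ x → Incident ends g x → Empty
    apart (here refl) g∈ fx gx with Joins∧Incident⇒≡ uw fx | evens-incident⇒∈ w st walk g∈ gx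
    ... | inj₁ refl | x∈st = All.lookup (All.tail u∉) x∈st refl
    ... | inj₂ refl | x∈st = All.lookup w∉ x∈st refl

  component-matchings : ∀ c → ValidComp ends c → Unique (compVerts c) →
                        IsMatching (odds (compEdges c)) × IsMatching (evens (compEdges c))
  component-matchings (path v st) walk c! = walk-matchings v st walk c!
  component-matchings (cycle v ((f₁ , v₁) ∷ (f₂ , v₂) ∷ st)) ((vv₁ , walk) , lst , evenSS st-even , _) c! =
    IsMatching-++ IsMatching-[ f₁ ] (proj₂ rec) apart , proj₁ rec
    where
    rec : IsMatching (odds (f₂ ∷ map proj₁ st)) × IsMatching (evens (f₂ ∷ map proj₁ st))
    rec = walk-matchings v₁ ((f₂ , v₂) ∷ st) walk c!
    v≡end : v ≡ endpoint v₂ st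
    v≡end = sym (last≡just⇒endpoint≡ v ((f₁ , v₁) ∷ (f₂ , v₂) ∷ st) lst)
    apart : ∀ {f g x} → f ∈ₗ [ f₁ ] → g ∈ₗ odds (map proj₁ st) → Incident ends f x → Incident ends g x → Empty
    apart (here refl) g∈ fx gx with Joins∧Incident⇒≡ vv₁ fx
    ... | inj₁ refl = odds-avoid-endpoint v₂ st (proj₂ walk) (AllPairs.tail c!) st-even g∈ gx v≡end
    ... | inj₂ refl = All.lookup (AllPairs.head c!) (evens-incident⇒∈ v₁ ((f₂ , v₂) ∷ st) walk g∈ gx) refl

  decomposition-matchings : ∀ D → All (ValidComp ends) D → Unique (vertices D) →
                            IsMatching (oddEdges D) × IsMatching (evenEdges D)
  decomposition-matchings []      _                   _  = (λ _ ()) , (λ _ ())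
  decomposition-matchings (c ∷ D) (c-valid ∷ D-valid) c∷D! =
    IsMatching-++ (proj₁ c-matchings) (proj₁ D-matchings) (apart (odds-⊆ (compEdges c)) (oddEdges-⊆ D)) ,
    IsMatching-++ (proj₂ c-matchings) (proj₂ D-matchings) (apart (evens-⊆ (compEdges c)) (evenEdges-⊆ D))
    where
    c-matchings : IsMatching (odds (compEdges c)) × IsMatching (evens (compEdges c))
    c-matchings = component-matchings c c-valid (Unique-++⁻ˡ (compVerts c) c∷D!)
    D-matchings : IsMatching (oddEdges D) × IsMatching (evenEdges D)
    D-matchings = decomposition-matchings D D-valid (Unique-++⁻ʳ (compVerts c) c∷D!)
    apart : ∀ {xs ys} → (∀ {f} → f ∈ₗ xs → f ∈ₗ compEdges c) → (∀ {g} → g ∈ₗ ys → g ∈ₗ edges D) →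
            ∀ {f g x} → f ∈ₗ xs → g ∈ₗ ys → Incident ends f x → Incident ends g x → Empty
    apart xs⊆c ys⊆D f∈ g∈ fx gx = Unique-++⇒disjoint (compVerts c) c∷D!
      (incident⇒∈compVerts c c-valid (xs⊆c f∈) fx) (incident⇒∈vertices D D-valid (ys⊆D g∈) gx)

matchings-of-pecDecomposition : ∀ {n m} (ends : Ends n m) {E′ D} → IsPecDecomposition ends E′ D →
  ∃[ H ] ∃[ H′ ] (DisjointMatchings ends E′ H H′ × pathCount D + (∣ H ∣ + ∣ H′ ∣) ≡ n)
matchings-of-pecDecomposition {n} ends {E′} {D} D-pec@(D-valid , D-vertices , D! , E′⇔D) =
  fromList (oddEdges D) , fromList (evenEdges D) ,
  (matching (oddEdges-⊆ D) (proj₁ matchings) , matching (evenEdges-⊆ D) (proj₂ matchings) , disjoint) ,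
  count
  where
  open ToMatchings ends using (IsMatching; decomposition-matchings)
  odds++evens! : Unique (oddEdges D ++ evenEdges D)
  odds++evens! = Unique-resp-↭ (↭-sym (oddEdges++evenEdges↭ D)) D!
  matchings : IsMatching (oddEdges D) × IsMatching (evenEdges D)
  matchings = decomposition-matchings D D-valid (Unique-resp-↭ (↭-sym D-vertices) (Unique.allFin⁺ n))
  matching : ∀ {es} → (∀ {f} → f ∈ₗ es → f ∈ₗ edges D) → IsMatching es → IsMatchingOf ends E′ (fromList es)
  matching es⊆D es-matching =
    (λ e∈ → Equivalence.from (E′⇔D _) (es⊆D (Equivalence.to ∈-fromList⇔∈ e∈))) ,
    (λ e f v e∈ f∈ ev fv → es-matching v (Equivalence.to ∈-fromList⇔∈ e∈) (Equivalence.to ∈-fromList⇔∈ f∈) ev fv)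
  disjoint : ∀ e → e ∈ fromList (oddEdges D) → e ∉ fromList (evenEdges D)
  disjoint e e∈ e∈′ =
    Unique-++⇒disjoint (oddEdges D) odds++evens! (Equivalence.to ∈-fromList⇔∈ e∈) (Equivalence.to ∈-fromList⇔∈ e∈′)
  count : pathCount D + (∣ fromList (oddEdges D) ∣ + ∣ fromList (evenEdges D) ∣) ≡ n
  count = begin
    pathCount D + (∣ fromList (oddEdges D) ∣ + ∣ fromList (evenEdges D) ∣)
      ≡⟨ cong (pathCount D +_) (cong₂ _+_ (∣fromList∣≡length (Unique-++⁻ˡ (oddEdges D) odds++evens!))
                                          (∣fromList∣≡length (Unique-++⁻ʳ (oddEdges D) odds++evens!))) ⟩
    pathCount D + (length (oddEdges D) + length (evenEdges D)) ≡⟨ cong (pathCount D +_) (length-++ (oddEdges D)) ⟨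
    pathCount D + length (oddEdges D ++ evenEdges D)           ≡⟨ cong (pathCount D +_) (Perm.↭-length (oddEdges++evenEdges↭ D)) ⟩
    pathCount D + length (edges D)                             ≡⟨ pathCount+#edges≡n ends D-pec ⟩
    n                                                          ∎
    where open ≡-Reasoning

lastSatisfying : ∀ {p} {P : ℕ → Set p} → (∀ k → Dec (P k)) → P 0 → ∀ k → ¬ P (suc k) →
                 ∃[ l ] (P l × ¬ P (suc l))
lastSatisfying P? P0 k ¬P[1+k] with P? k
... | yes Pk = k , Pk , ¬P[1+k]
lastSatisfying P? P0 zero    _ | no ¬P0  = ⊥-elim (¬P0 P0)
lastSatisfying P? P0 (suc k) _ | no ¬Pk = lastSatisfying P? P0 k ¬Pk

DisjointMatchings⇒⊤ : ∀ {n m} {ends : Ends n m} {F H H′} → DisjointMatchings ends F H H′ → DisjointMatchings ends ⊤ H H′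
DisjointMatchings⇒⊤ ((_ , H-matching) , (_ , H′-matching) , H∩H′≡∅) =
  ((λ _ → ∈⊤) , H-matching) , ((λ _ → ∈⊤) , H′-matching) , H∩H′≡∅

module _ {n m : ℕ} (ends : Ends n m) where

  Incident? : ∀ e v → Dec (Incident ends e v)
  Incident? e v = (proj₁ (ends e) ≟ᶠ v) ⊎-dec (proj₂ (ends e) ≟ᶠ v)

  IsMatchingOf? : ∀ H → Dec (IsMatchingOf ends ⊤ H)
  IsMatchingOf? H = yes (λ _ → ∈⊤) ×-dec
    all? λ e → all? λ f → all? λ v →
      (e ∈? H) →-dec (f ∈? H) →-dec Incident? e v →-dec Incident? f v →-dec (e ≟ᶠ f)

  DisjointMatchings? : ∀ H H′ → Dec (DisjointMatchings ends ⊤ H H′)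
  DisjointMatchings? H H′ = IsMatchingOf? H ×-dec IsMatchingOf? H′ ×-dec
    all? λ e → (e ∈? H) →-dec ((e ∈? H′) →-dec no (λ ()))

  λ-exists : ∃[ l ] IsLambda ends ⊤ l
  λ-exists with lastSatisfying AtLeast? (∅ , ∅ , (∅-matching , ∅-matching , λ _ → ⊥-elim ∘ ∉⊥) , z≤n) (m + m) ¬AtLeast[1+2m]
    where
    AtLeast : ℕ → Set
    AtLeast k = ∃[ H ] ∃[ H′ ] (DisjointMatchings ends ⊤ H H′ × k ≤ ∣ H ∣ + ∣ H′ ∣)
    AtLeast? : ∀ k → Dec (AtLeast k)
    AtLeast? k = anySubset? λ H → anySubset? λ H′ → DisjointMatchings? H H′ ×-dec (k ≤? ∣ H ∣ + ∣ H′ ∣)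
    ∅-matching : IsMatchingOf ends ⊤ ∅
    ∅-matching = (λ _ → ∈⊤) , λ _ _ _ e∈∅ → ⊥-elim (∉⊥ e∈∅)
    ¬AtLeast[1+2m] : ¬ AtLeast (suc (m + m))
    ¬AtLeast[1+2m] (H , H′ , _ , 1+2m≤) = <⇒≱ (s≤s (+-mono-≤ (∣p∣≤n H) (∣p∣≤n H′))) 1+2m≤
  ... | l , (H , H′ , HH′ , l≤) , ¬AtLeast[1+l] =
    l , (H , H′ , HH′ , ≤-antisym (≮⇒≥ (λ l< → ¬AtLeast[1+l] (H , H′ , HH′ , l<))) l≤)
      , λ G G′ GG′ → ≮⇒≥ (λ l< → ¬AtLeast[1+l] (G , G′ , GG′ , l<))

module _ {n m : ℕ} (ends : Ends n m) (loopless : Loopless ends) where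

  n≤pathCount+λ : ∀ {l E′ D} → IsLambda ends ⊤ l → IsPecDecomposition ends E′ D → n ≤ pathCount D + l
  n≤pathCount+λ {l} {D = D} (_ , maximal) D-pec with matchings-of-pecDecomposition ends D-pec
  ... | G , G′ , GG′ , D-count = begin
    n                               ≡⟨ D-count ⟨
    pathCount D + (∣ G ∣ + ∣ G′ ∣) ≤⟨ +-monoʳ-≤ (pathCount D) (maximal G G′ (DisjointMatchings⇒⊤ GG′)) ⟩
    pathCount D + l                 ∎
    where open ≤-Reasoning

  minPaths-exists : ∃[ p ] IsMinPaths ends p
  minPaths-exists with λ-exists ends
  ... | l , isλ@((H , H′ , HH′ , size≡l) , _) with pecDecomposition-of-matchings ends loopless HH′
  ...   | D , D-pec , D-count = pathCount D , (H ∪ H′ , D , D-pec , refl) , minimal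
    where
    minimal : ∀ E′ D′ → IsPecDecomposition ends E′ D′ → pathCount D ≤ pathCount D′
    minimal E′ D′ D′-pec = +-cancelʳ-≤ l _ _ (begin
      pathCount D + l                ≡⟨ cong (pathCount D +_) size≡l ⟨
      pathCount D + (∣ H ∣ + ∣ H′ ∣) ≡⟨ D-count ⟩
      n                              ≤⟨ n≤pathCount+λ isλ D′-pec ⟩
      pathCount D′ + l               ∎)
      where open ≤-Reasoning

  minPaths+λ≡n : ∀ {l p} → IsLambda ends ⊤ l → IsMinPaths ends p → p + l ≡ n
  minPaths+λ≡n {l} {p} isλ@((H , H′ , HH′ , size≡l) , _) ((_ , D₀ , D₀-pec , D₀≡p) , minimal)
    with pecDecomposition-of-matchings ends loopless HH′
  ... | D , D-pec , D-count = ≤-antisym (begin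
    p + l                          ≡⟨ cong (p +_) size≡l ⟨
    p + (∣ H ∣ + ∣ H′ ∣)           ≤⟨ +-monoˡ-≤ _ (minimal _ D D-pec) ⟩
    pathCount D + (∣ H ∣ + ∣ H′ ∣) ≡⟨ D-count ⟩
    n                              ∎) (begin
    n                              ≤⟨ n≤pathCount+λ isλ D₀-pec ⟩
    pathCount D₀ + l               ≡⟨ cong (_+ l) D₀≡p ⟩
    p + l                          ∎)
    where open ≤-Reasoning

  optimal-pec-of-Λ : ∀ H H′ → InΛ ends ⊤ H H′ →
    ∃[ D ] (IsPecDecomposition ends (H ∪ H′) D × (∀ p → IsMinPaths ends p → pathCount D ≡ p))
  optimal-pec-of-Λ H H′ (HH′ , isλ) with pecDecomposition-of-matchings ends loopless HH′
  ... | D , D-pec , D-count =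
    D , D-pec , λ p p-min → +-cancelʳ-≡ _ (pathCount D) p (trans D-count (sym (minPaths+λ≡n isλ p-min)))

  Λ-of-optimal-pec : ∀ E′ D → IsPecDecomposition ends E′ D → (∀ p → IsMinPaths ends p → pathCount D ≡ p) →
                     ∀ H H′ → InΛ ends E′ H H′ → InΛ ends ⊤ H H′
  Λ-of-optimal-pec E′ D D-pec D-optimal H H′ (HH′ , _ , E′-maximal) =
    DisjointMatchings⇒⊤ HH′ , subst (IsLambda ends ⊤) (sym size≡l) isλ
    where
    l : ℕ
    l = proj₁ (λ-exists ends)
    isλ : IsLambda ends ⊤ l
    isλ = proj₂ (λ-exists ends)
    p : ℕ
    p = proj₁ minPaths-exists
    p-min : IsMinPaths ends p
    p-min = proj₂ minPaths-exists
    size≡l : ∣ H ∣ + ∣ H′ ∣ ≡ l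
    size≡l with matchings-of-pecDecomposition ends D-pec
    ... | G , G′ , GG′ , D-count = ≤-antisym (proj₂ isλ H H′ (DisjointMatchings⇒⊤ HH′)) (+-cancelˡ-≤ p _ _ (begin
      p + l                          ≡⟨ minPaths+λ≡n isλ p-min ⟩
      n                              ≡⟨ D-count ⟨
      pathCount D + (∣ G ∣ + ∣ G′ ∣) ≡⟨ cong (_+ _) (D-optimal p p-min) ⟩
      p + (∣ G ∣ + ∣ G′ ∣)           ≤⟨ +-monoʳ-≤ p (E′-maximal G G′ GG′) ⟩
      p + (∣ H ∣ + ∣ H′ ∣)           ∎))
      where open ≤-Reasoning

mainTheorem7 : ∀ {n m} (ends : Ends n m) → Loopless ends →
    (∀ l p → IsLambda ends ⊤ l → IsMinPaths ends p → l ≡ n ∸ p)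
    × (∀ H H' → InΛ ends ⊤ H H' →
         ∃[ D ] (IsPecDecomposition ends (H ∪ H') D
                 × (∀ p → IsMinPaths ends p → pathCount D ≡ p)))
    × (∀ (E' : Subset m) (D : List (Comp n m)) → IsPecDecomposition ends E' D →
         (∀ p → IsMinPaths ends p → pathCount D ≡ p) →
         ∀ H H' → InΛ ends E' H H' → InΛ ends ⊤ H H')
mainTheorem7 ends loopless =
  (λ l p isλ p-min → trans (sym (m+n∸m≡n p l)) (cong (_∸ p) (minPaths+λ≡n ends loopless isλ p-min))) ,
  optimal-pec-of-Λ ends loopless ,
  Λ-of-optimal-pec ends loopless
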